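{- Let $t\ge 2$ and $1\le n\le t$ be integers, and let $M_{ -t}(n)$ be the minimum, over all $2$-colorings $\Delta:[1-t,n-t]\to\{0,1\}$, of the number of monochromatic triples $(x_1,x_2,x_3)$ with $x_1,x_2,x_3\in[1-t,n-t]$, $x_1\le x_2\le x_3$ and $x_1+x_2<x_3$. Then \[ M_{ -t}(n)= \begin{cases} \dbinom{\lfloor n/2\rfloor+2}{3}+\dbinom{\lceil n/2\rceil+2}{3}, & 1\le n<t,\\[2mm] \dbinom{\lfloor t/2\rfloor+2}{3}+\dbinom{\lceil t/2\rceil+2}{3}-1, & n=t. \end{cases} \]
   Context: For integers $a\le b$, $[a,b]=\{m\in\mathbb Z:a\le m\le b\}$. A triple is monochromatic under $\Delta$ if $\Delta(x_1)=\Delta(x_2)=\Delta(x_3)$. In general, for $k\in\mathbb Z$ and $n\ge1$, $M_k(n)$ denotes the minimum over all $2$-colorings of $[k+1,k+n]$ of the number of monochromatic solutions in $[k+1,k+n]$ of the system $x_1\le x_2\le x_3$, $x_1+x_2<x_3$; here $k=-t$. -}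

module Defs where

open import Data.Nat as ℕ using (ℕ; zero; suc; _⊓_; _/_; _∸_)
open import Data.Nat.Combinatorics using (_C_)
open import Data.Integer as ℤ using (ℤ; +_; _-_; _+_)
open import Data.Integer.Properties using (_≟_)
open import Data.Bool using (Bool; true; false)
open import Data.Bool.Properties renaming (_≟_ to _≟ᵇ_)
open import Data.List using (List; []; _∷_; map; concatMap; filter; length; foldr; upTo)
open import Data.Product using (_×_; _,_)
open import Relation.Nullary.Decidable using (_×-dec_; does)
open import Data.Bool using (if_then_else_)
open import Relation.Binary.PropositionalEquality using (_≡_)

interval : ℤ → ℕ → List ℤ
interval a n = map (λ i → a + + i) (upTo n)

-- A 2-colouring of [k+1, k+n] (k ∈ ℤ).  We represent it as a function
-- ℤ → Bool; only its values on [k+1,k+n] matter.  All colourings of the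
-- interval are enumerated below as functions agreeing with a Bool list
-- on the interval (positions 0..n-1 ↦ k+1..k+n).
Coloring : Set
Coloring = ℤ → Bool

boolLists : ℕ → List (List Bool)
boolLists zero    = [] ∷ []
boolLists (suc n) = concatMap (λ bs → (false ∷ bs) ∷ (true ∷ bs) ∷ []) (boolLists n)

-- colouring determined by a list bs on the interval starting at a
-- (value false outside the interval; irrelevant)
fromList : ℤ → List Bool → Coloring
fromList a []       x = false
fromList a (b ∷ bs) x = if does (x ≟ a) then b else fromList (a + + 1) bs x

allColorings : ℤ → ℕ → List Coloring
allColorings k n = map (fromList (k + + 1)) (boolLists n)

triples : ℤ → ℕ → List (ℤ × ℤ × ℤ)
triples k n =
  concatMap (λ x₁ → concatMap (λ x₂ → map (λ x₃ → x₁ , x₂ , x₃) I) I) I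
  where I = interval (k + + 1) n

countMono : ℤ → ℕ → Coloring → ℕ
countMono k n Δ = length (filter P? (triples k n))
  where
  P? : (p : ℤ × ℤ × ℤ) → _
  P? (x₁ , x₂ , x₃) =
    (x₁ ℤ.≤? x₂) ×-dec (x₂ ℤ.≤? x₃) ×-dec (x₁ + x₂ ℤ.<? x₃)
    ×-dec (Δ x₁ ≟ᵇ Δ x₂) ×-dec (Δ x₂ ≟ᵇ Δ x₃)

minList : ℕ → List ℕ → ℕ
minList d []       = d
minList d (x ∷ xs) = foldr _⊓_ x xs

M : ℤ → ℕ → ℕ
M k n = minList 0 (map (countMono k n) (allColorings k n))

⌈_/2⌉ : ℕ → ℕ
⌈ n /2⌉ = (suc n) / 2

-- Write the points of [1 - t, n - t] as 1 - t + i with 0 ≤ i < n.  For i ≤ j ≤ l the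
-- condition x₁ + x₂ < x₃ reads i + j + 1 < t + l, which fails only for i = j = l = t - 1,
-- and that triple lies in the range only when n = t.  Hence a coloring whose classes have
-- p and q elements has exactly C(p+2,3) + C(q+2,3) − [n = t] monochromatic solutions, one
-- for each monochromatic 3-multiset.  Since x ↦ C(x+2,3) has nondecreasing increments, the
-- minimum over p + q = n is attained at the balanced split, e.g. by two blocks of colors.

module Submission where

open import Defs
open import Data.Nat using (ℕ; _≤_; _<_; _+_; _∸_; _/_)
open import Data.Nat.Combinatorics using (_C_)
open import Data.Integer using (-_; +_)
open import Relation.Binary.PropositionalEquality using (_≡_)
open import Data.Product using (_×_)

open import Data.Bool using (Bool; true; false; if_then_else_)
open import Data.Bool.Properties using () renaming (_≟_ to _≟ᵇ_)
open import Data.Integer as ℤ using (ℤ; +≤+; +<+)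
import Data.Integer.Properties as ℤP
open import Data.Integer.Tactic.RingSolver using (solve-∀)
open import Data.List using (List; []; _∷_; _++_; map; concatMap; filter; length; applyUpTo; replicate)
open import Data.List.Properties
  using (filter-++; length-++; map-cong; map-∘; length-replicate; foldr-preservesᵇ; foldr-preservesᵒ)
open import Data.List.Membership.Propositional using (_∈_)
open import Data.List.Membership.Propositional.Properties using (∈-map⁺; ∈-concatMap⁺)
open import Data.List.Relation.Unary.All as All using (All; _∷_)
import Data.List.Relation.Unary.All.Properties as AllP
open import Data.List.Relation.Unary.Any as Any using (here; there)
open import Data.Nat using (zero; suc; z≤n; s≤s; s<s⁻¹; _≤?_; _<?_; _≟_; ⌊_/2⌋)
open import Data.Nat.Combinatorics using (nCk+nC[k+1]≡[n+1]C[k+1]; nC1≡n)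
open import Data.Nat.DivMod using (m/n≡1+[m∸n]/n)
open import Data.Nat.ListAction using (sum)
import Data.Nat.Properties as ℕP
open import Algebra.Properties.CommutativeSemigroup ℕP.+-commutativeSemigroup
  using (interchange; x∙yz≈y∙xz; x∙yz≈yx∙z)
open import Data.Product as Product using (_,_; proj₁; proj₂)
open import Data.Product.Function.NonDependent.Propositional using (_×-⇔_)
open import Data.Sum using (_⊎_; inj₁; inj₂; [_,_])
open import Function using (_∘_; id; _⇔_; mk⇔; Equivalence)
open import Function.Construct.Identity using (⇔-id)
open import Relation.Nullary using (Dec; ¬_; does; yes; no)
open import Relation.Nullary.Decidable using (_×-dec_; dec-true; dec-false; does-⇔)
open import Relation.Binary.PropositionalEquality
  using (_≢_; refl; sym; trans; cong; cong₂; subst; subst₂; module ≡-Reasoning)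

𝟙 : {A : Set} → Dec A → ℕ
𝟙 a? = if does a? then 1 else 0

𝟙-yes : {A : Set} (a? : Dec A) → A → 𝟙 a? ≡ 1
𝟙-yes a? a = cong (λ b → if b then 1 else 0) (dec-true a? a)

𝟙-no : {A : Set} (a? : Dec A) → ¬ A → 𝟙 a? ≡ 0
𝟙-no a? ¬a = cong (λ b → if b then 1 else 0) (dec-false a? ¬a)

𝟙-⇔ : {A B : Set} → A ⇔ B → (a? : Dec A) (b? : Dec B) → 𝟙 a? ≡ 𝟙 b?
𝟙-⇔ A⇔B a? b? = cong (λ b → if b then 1 else 0) (does-⇔ A⇔B a? b?)

∑< : ℕ → (ℕ → ℕ) → ℕ
∑< zero    f = 0
∑< (suc n) f = f n + ∑< n f

infix 5 ∑<
syntax ∑< n (λ i → e) = ∑[ i < n ] e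

∑<-cong : ∀ n {f g : ℕ → ℕ} → (∀ {i} → i < n → f i ≡ g i) → ∑< n f ≡ ∑< n g
∑<-cong zero    f≗g = refl
∑<-cong (suc n) f≗g = cong₂ _+_ (f≗g ℕP.≤-refl) (∑<-cong n (f≗g ∘ ℕP.m<n⇒m<1+n))

∑<-zero : ∀ n {f : ℕ → ℕ} → (∀ {i} → i < n → f i ≡ 0) → ∑< n f ≡ 0
∑<-zero zero    f≗0 = refl
∑<-zero (suc n) f≗0 = cong₂ _+_ (f≗0 ℕP.≤-refl) (∑<-zero n (f≗0 ∘ ℕP.m<n⇒m<1+n))

∑<-+ : ∀ n (f g : ℕ → ℕ) → ∑[ i < n ] (f i + g i) ≡ ∑< n f + ∑< n g
∑<-+ zero    f g = refl
∑<-+ (suc n) f g =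
  trans (cong (_+_ (f n + g n)) (∑<-+ n f g)) (interchange (f n) (g n) (∑< n f) (∑< n g))

∑<-shift : ∀ n (f : ℕ → ℕ) → ∑< (suc n) f ≡ f 0 + (∑[ i < n ] f (suc i))
∑<-shift zero    f = refl
∑<-shift (suc n) f =
  trans (cong (_+_ (f (suc n))) (∑<-shift n f)) (x∙yz≈y∙xz (f (suc n)) (f 0) _)

square : ℕ → (ℕ → ℕ → ℕ) → ℕ
square n G = ∑[ i < n ] ∑[ j < n ] G i j

cube : ℕ → (ℕ → ℕ → ℕ → ℕ) → ℕ
cube n F = ∑[ i < n ] ∑[ j < n ] ∑[ l < n ] F i j l

cube-cong : ∀ n {F G : ℕ → ℕ → ℕ → ℕ} → (∀ i j l → F i j l ≡ G i j l) →
  cube n F ≡ cube n G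
cube-cong n F≗G = ∑<-cong n λ _ → ∑<-cong n λ _ → ∑<-cong n λ _ → F≗G _ _ _

square-suc : ∀ m G →
  square (suc m) G ≡ (∑[ i < suc m ] G i m) + ((∑[ j < m ] G m j) + square m G)
square-suc m G = ∑<-+ (suc m) (λ i → G i m) (λ i → ∑[ j < m ] G i j)

UpperTriangular : (ℕ → ℕ → ℕ) → Set
UpperTriangular G = ∀ {i j} → j < i → G i j ≡ 0

square-suc-upper : ∀ m {G} → UpperTriangular G →
  square (suc m) G ≡ (∑[ i < suc m ] G i m) + square m G
square-suc-upper m {G} upper =
  trans (square-suc m G) (cong (λ s → (∑[ i < suc m ] G i m) + (s + square m G)) (∑<-zero m upper))

Chain : ℕ → ℕ → ℕ → Set
Chain i j l = i ≤ j × j ≤ l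

SupportedOnChains : (ℕ → ℕ → ℕ → ℕ) → Set
SupportedOnChains F = ∀ {i j l} → ¬ Chain i j l → F i j l ≡ 0

cube-suc : ∀ n {F} → SupportedOnChains F →
  cube (suc n) F ≡ square (suc n) (λ i j → F i j n) + cube n F
cube-suc n {F} supported = begin
    cube (suc n) F
  ≡⟨ ∑<-cong (suc n) (λ {i} _ → ∑<-+ (suc n) (λ j → F i j n) (Φ i)) ⟩
    (∑[ i < suc n ] ((∑[ j < suc n ] F i j n) + (∑[ j < suc n ] Φ i j)))
  ≡⟨ ∑<-+ (suc n) (λ i → ∑[ j < suc n ] F i j n) (λ i → ∑[ j < suc n ] Φ i j) ⟩
    square (suc n) (λ i j → F i j n) + square (suc n) Φ
  ≡⟨ cong (_+_ (square (suc n) (λ i j → F i j n))) Φ-square ⟩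
    square (suc n) (λ i j → F i j n) + cube n F ∎
  where
  open ≡-Reasoning
  Φ : ℕ → ℕ → ℕ
  Φ i j = ∑[ l < n ] F i j l
  Φ-square : square (suc n) Φ ≡ cube n F
  Φ-square = trans (square-suc n Φ) (cong₂ (λ x y → x + (y + cube n F))
    (∑<-zero (suc n) λ _ → ∑<-zero n λ l<n → supported λ (_ , n≤l) → ℕP.<⇒≱ l<n n≤l)
    (∑<-zero n λ _ → ∑<-zero n λ l<n →
      supported λ (n≤j , j≤l) → ℕP.<⇒≱ l<n (ℕP.≤-trans n≤j j≤l)))

module _ {A : Set} {P : A → Set} (P? : ∀ x → Dec (P x)) where

  length-filter-map : ∀ {B : Set} (h : B → A) xs →
    length (filter P? (map h xs)) ≡ sum (map (λ x → 𝟙 (P? (h x))) xs)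
  length-filter-map h []       = refl
  length-filter-map h (x ∷ xs) with does (P? (h x))
  ... | true  = cong suc (length-filter-map h xs)
  ... | false = length-filter-map h xs

  length-filter-concatMap : ∀ {B : Set} (h : B → List A) xs →
    length (filter P? (concatMap h xs)) ≡ sum (map (λ x → length (filter P? (h x))) xs)
  length-filter-concatMap h []       = refl
  length-filter-concatMap h (x ∷ xs) = begin
      length (filter P? (h x ++ concatMap h xs))
    ≡⟨ cong length (filter-++ P? (h x) (concatMap h xs)) ⟩
      length (filter P? (h x) ++ filter P? (concatMap h xs))
    ≡⟨ length-++ (filter P? (h x)) ⟩
      length (filter P? (h x)) + length (filter P? (concatMap h xs))
    ≡⟨ cong (_+_ (length (filter P? (h x)))) (length-filter-concatMap h xs) ⟩
      length (filter P? (h x)) + sum (map (λ x → length (filter P? (h x))) xs) ∎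
    where open ≡-Reasoning

length-filter-triples : ∀ {A : Set} {P : A × A × A → Set} (P? : ∀ p → Dec (P p)) xs →
  length (filter P? (concatMap (λ x → concatMap (λ y → map (λ z → x , y , z) xs) xs) xs))
  ≡ sum (map (λ x → sum (map (λ y → sum (map (λ z → 𝟙 (P? (x , y , z))) xs)) xs)) xs)
length-filter-triples P? xs =
  trans (length-filter-concatMap P? _ xs) (cong sum (map-cong (λ x →
    trans (length-filter-concatMap P? _ xs) (cong sum (map-cong (λ y →
      length-filter-map P? _ xs) xs))) xs))

sum-map-applyUpTo : ∀ (f : ℕ → ℕ) g n → sum (map f (applyUpTo g n)) ≡ ∑[ i < n ] f (g i)
sum-map-applyUpTo f g zero    = refl
sum-map-applyUpTo f g (suc n) =
  trans (cong (_+_ (f (g 0))) (sum-map-applyUpTo f (g ∘ suc) n)) (sym (∑<-shift n (f ∘ g)))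

sum-map-interval : ∀ a n (f : ℤ → ℕ) → sum (map f (interval a n)) ≡ ∑[ i < n ] f (a ℤ.+ + i)
sum-map-interval a n f =
  trans (cong sum (sym (map-∘ (applyUpTo id n)))) (sum-map-applyUpTo (λ i → f (a ℤ.+ + i)) id n)

shift : ℤ → ℕ → ℤ
shift k i = k ℤ.+ + 1 ℤ.+ + i

MonoSolutionℤ : Coloring → ℤ → ℤ → ℤ → Set
MonoSolutionℤ Δ x₁ x₂ x₃ =
  x₁ ℤ.≤ x₂ × x₂ ℤ.≤ x₃ × x₁ ℤ.+ x₂ ℤ.< x₃ × Δ x₁ ≡ Δ x₂ × Δ x₂ ≡ Δ x₃

-- The predicate filtered in countMono, copied verbatim so that the two agree definitionally.
monoSolutionℤ? : ∀ Δ x₁ x₂ x₃ → Dec (MonoSolutionℤ Δ x₁ x₂ x₃)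
monoSolutionℤ? Δ x₁ x₂ x₃ =
  (x₁ ℤ.≤? x₂) ×-dec (x₂ ℤ.≤? x₃) ×-dec (x₁ ℤ.+ x₂ ℤ.<? x₃)
  ×-dec (Δ x₁ ≟ᵇ Δ x₂) ×-dec (Δ x₂ ≟ᵇ Δ x₃)

countMono-as-cube : ∀ k n Δ → countMono k n Δ ≡
  cube n (λ i j l → 𝟙 (monoSolutionℤ? Δ (shift k i) (shift k j) (shift k l)))
countMono-as-cube k n Δ =
  trans (length-filter-triples _ I)
    (trans (sum-map-interval a n _) (∑<-cong n λ _ →
      trans (sum-map-interval a n _) (∑<-cong n λ _ → sum-map-interval a n _)))
  where
  a : ℤ
  a = k ℤ.+ + 1
  I : List ℤ
  I = interval a n

-- From [1 - t, n - t] to [0, n)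

-i+[i+j]≡j : ∀ i j → - i ℤ.+ (i ℤ.+ j) ≡ j
-i+[i+j]≡j = solve-∀

ℤ+-cancelˡ-≤ : ∀ c {x y} → c ℤ.+ x ℤ.≤ c ℤ.+ y → x ℤ.≤ y
ℤ+-cancelˡ-≤ c {x} {y} = subst₂ ℤ._≤_ (-i+[i+j]≡j c x) (-i+[i+j]≡j c y) ∘ ℤP.+-monoʳ-≤ (- c)

ℤ+-cancelˡ-< : ∀ c {x y} → c ℤ.+ x ℤ.< c ℤ.+ y → x ℤ.< y
ℤ+-cancelˡ-< c {x} {y} = subst₂ ℤ._<_ (-i+[i+j]≡j c x) (-i+[i+j]≡j c y) ∘ ℤP.+-monoʳ-< (- c)

+-translate-injective : ∀ c {m n} → c ℤ.+ + m ≡ c ℤ.+ + n → m ≡ n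
+-translate-injective c {m} {n} eq =
  ℤP.+-injective (trans (sym (-i+[i+j]≡j c (+ m))) (trans (cong (ℤ._+_ (- c)) eq) (-i+[i+j]≡j c (+ n))))

+-translate-suc-≢ : ∀ a i → a ℤ.+ + suc i ≢ a
+-translate-suc-≢ a i eq = ℕP.1+n≢0 (+-translate-injective a (trans eq (sym (ℤP.+-identityʳ a))))

+-translate-≤-⇔ : ∀ c m n → (c ℤ.+ + m ℤ.≤ c ℤ.+ + n) ⇔ m ≤ n
+-translate-≤-⇔ c m n = mk⇔ (ℤP.drop‿+≤+ ∘ ℤ+-cancelˡ-≤ c) (ℤP.+-monoʳ-≤ c ∘ +≤+)

+-translate-<-⇔ : ∀ c m n → (c ℤ.+ + m ℤ.< c ℤ.+ + n) ⇔ m < n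
+-translate-<-⇔ c m n = mk⇔ (ℤP.drop‿+<+ ∘ ℤ+-cancelˡ-< c) (ℤP.+-monoʳ-< c ∘ +<+)

<-⇔-of-translates : ∀ c e {u v m n} → c ℤ.+ u ≡ e ℤ.+ + m → c ℤ.+ v ≡ e ℤ.+ + n →
  (u ℤ.< v) ⇔ (m < n)
<-⇔-of-translates c e {m = m} {n} cu≡ cv≡ = mk⇔
  (λ u<v → Equivalence.to (+-translate-<-⇔ e m n) (subst₂ ℤ._<_ cu≡ cv≡ (ℤP.+-monoʳ-< c u<v)))
  (λ m<n → ℤ+-cancelˡ-< c
    (subst₂ ℤ._<_ (sym cu≡) (sym cv≡) (Equivalence.from (+-translate-<-⇔ e m n) m<n)))

SumFree : ℕ → ℕ → ℕ → ℕ → Set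
SumFree t i j l = suc (i + j) < t + l

shift-≤-⇔ : ∀ k i j → (shift k i ℤ.≤ shift k j) ⇔ i ≤ j
shift-≤-⇔ k = +-translate-≤-⇔ (k ℤ.+ + 1)

shift-sumFree-⇔ : ∀ t i j l →
  (shift (- + t) i ℤ.+ shift (- + t) j ℤ.< shift (- + t) l) ⇔ SumFree t i j l
shift-sumFree-⇔ t i j l = <-⇔-of-translates (+ t ℤ.+ + l) (s l) lhs rhs
  where
  s : ℕ → ℤ
  s = shift (- + t)
  identity : ∀ T I J L → T ℤ.+ L ℤ.+ ((- T ℤ.+ + 1 ℤ.+ I) ℤ.+ (- T ℤ.+ + 1 ℤ.+ J))
                         ≡ (- T ℤ.+ + 1 ℤ.+ L) ℤ.+ (+ 1 ℤ.+ (I ℤ.+ J))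
  identity = solve-∀
  lhs : + t ℤ.+ + l ℤ.+ (s i ℤ.+ s j) ≡ s l ℤ.+ + suc (i + j)
  lhs = trans (identity (+ t) (+ i) (+ j) (+ l)) (cong (ℤ._+_ (s l))
    (trans (cong (ℤ._+_ (+ 1)) (sym (ℤP.pos-+ i j))) (sym (ℤP.pos-+ 1 (i + j)))))
  rhs : + t ℤ.+ + l ℤ.+ s l ≡ s l ℤ.+ + (t + l)
  rhs = trans (ℤP.+-comm (+ t ℤ.+ + l) (s l)) (cong (ℤ._+_ (s l)) (sym (ℤP.pos-+ t l)))

MonoSolution : ℕ → (ℕ → Bool) → ℕ → ℕ → ℕ → Set
MonoSolution t c i j l = i ≤ j × j ≤ l × SumFree t i j l × c i ≡ c j × c j ≡ c l

monoSolution? : ∀ t c i j l → Dec (MonoSolution t c i j l)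
monoSolution? t c i j l =
  i ≤? j ×-dec j ≤? l ×-dec suc (i + j) <? t + l ×-dec c i ≟ᵇ c j ×-dec c j ≟ᵇ c l

monoSolution : ℕ → (ℕ → Bool) → ℕ → ℕ → ℕ → ℕ
monoSolution t c i j l = 𝟙 (monoSolution? t c i j l)

MonoChain : (ℕ → Bool) → ℕ → ℕ → ℕ → Set
MonoChain c i j l = i ≤ j × j ≤ l × c i ≡ c j × c j ≡ c l

monoChain? : ∀ c i j l → Dec (MonoChain c i j l)
monoChain? c i j l = i ≤? j ×-dec j ≤? l ×-dec c i ≟ᵇ c j ×-dec c j ≟ᵇ c l

monoChain : (ℕ → Bool) → ℕ → ℕ → ℕ → ℕ
monoChain c i j l = 𝟙 (monoChain? c i j l)

monoSolutionℤ-shift : ∀ t Δ i j l →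
  𝟙 (monoSolutionℤ? Δ (shift (- + t) i) (shift (- + t) j) (shift (- + t) l))
  ≡ monoSolution t (Δ ∘ shift (- + t)) i j l
monoSolutionℤ-shift t Δ i j l = 𝟙-⇔
  (shift-≤-⇔ (- + t) i j ×-⇔ shift-≤-⇔ (- + t) j l ×-⇔ shift-sumFree-⇔ t i j l
    ×-⇔ ⇔-id (c i ≡ c j) ×-⇔ ⇔-id (c j ≡ c l))
  (monoSolutionℤ? Δ (shift (- + t) i) (shift (- + t) j) (shift (- + t) l))
  (monoSolution? t c i j l)
  where
  c : ℕ → Bool
  c = Δ ∘ shift (- + t)

-- Monochromatic 3-multisets

classSize : (ℕ → Bool) → Bool → ℕ → ℕ
classSize c b n = ∑[ i < n ] 𝟙 (c i ≟ᵇ b)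

classSize-suc-≡ : ∀ c n {b} → c n ≡ b → classSize c b (suc n) ≡ suc (classSize c b n)
classSize-suc-≡ c n {b} cn≡b = cong (λ x → x + classSize c b n) (𝟙-yes (c n ≟ᵇ b) cn≡b)

classSize-suc-≢ : ∀ c n {b} → c n ≢ b → classSize c b (suc n) ≡ classSize c b n
classSize-suc-≢ c n {b} cn≢b = cong (λ x → x + classSize c b n) (𝟙-no (c n ≟ᵇ b) cn≢b)

classSize-true+false : ∀ c n → classSize c true n + classSize c false n ≡ n
classSize-true+false c zero    = refl
classSize-true+false c (suc n) =
  trans (interchange (𝟙 (c n ≟ᵇ true)) (classSize c true n) (𝟙 (c n ≟ᵇ false)) (classSize c false n))
        (cong₂ _+_ (exactly-one (c n)) (classSize-true+false c n))
  where
  exactly-one : ∀ b → 𝟙 (b ≟ᵇ true) + 𝟙 (b ≟ᵇ false) ≡ 1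
  exactly-one true  = refl
  exactly-one false = refl

multichoose₂ : ℕ → ℕ
multichoose₂ x = (1 + x) C 2

multichoose₃ : ℕ → ℕ
multichoose₃ x = (2 + x) C 3

multichoose₂-suc : ∀ x → multichoose₂ (suc x) ≡ suc x + multichoose₂ x
multichoose₂-suc x = begin
    (2 + x) C 2                    ≡⟨ nCk+nC[k+1]≡[n+1]C[k+1] (1 + x) 1 ⟨
    (1 + x) C 1 + (1 + x) C 2      ≡⟨ cong (λ y → y + (1 + x) C 2) (nC1≡n (1 + x)) ⟩
    suc x + multichoose₂ x         ∎
  where open ≡-Reasoning

multichoose₃-suc : ∀ x → multichoose₃ (suc x) ≡ multichoose₂ (suc x) + multichoose₃ x
multichoose₃-suc x = sym (nCk+nC[k+1]≡[n+1]C[k+1] (2 + x) 2)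

multichoose₂-mono : ∀ {x y} → x ≤ y → multichoose₂ x ≤ multichoose₂ y
multichoose₂-mono {y = zero}  z≤n = ℕP.≤-refl
multichoose₂-mono {x} {suc y} x≤1+y with ℕP.m≤n⇒m<n∨m≡n x≤1+y
... | inj₂ refl  = ℕP.≤-refl
... | inj₁ x<1+y = ℕP.≤-trans (multichoose₂-mono (ℕP.≤-pred x<1+y))
  (subst (multichoose₂ y ≤_) (sym (multichoose₂-suc y)) (ℕP.m≤n+m (multichoose₂ y) (suc y)))

monoChainCount : (ℕ → Bool) → ℕ → ℕ
monoChainCount c n = multichoose₃ (classSize c true n) + multichoose₃ (classSize c false n)

monoChainCount-suc : ∀ c n →
  monoChainCount c (suc n) ≡ multichoose₂ (classSize c (c n) (suc n)) + monoChainCount c n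
-- Abstracting c n also rewrites it inside classSize c b (suc n), which then computes.
monoChainCount-suc c n with c n
... | true = begin
    multichoose₃ (suc P) + multichoose₃ Q
  ≡⟨ cong (λ x → x + multichoose₃ Q) (multichoose₃-suc P) ⟩
    multichoose₂ (suc P) + multichoose₃ P + multichoose₃ Q
  ≡⟨ ℕP.+-assoc (multichoose₂ (suc P)) (multichoose₃ P) (multichoose₃ Q) ⟩
    multichoose₂ (suc P) + monoChainCount c n ∎
  where
  open ≡-Reasoning
  P Q : ℕ
  P = classSize c true n
  Q = classSize c false n
... | false = begin
    multichoose₃ P + multichoose₃ (suc Q)
  ≡⟨ cong (_+_ (multichoose₃ P)) (multichoose₃-suc Q) ⟩
    multichoose₃ P + (multichoose₂ (suc Q) + multichoose₃ Q)
  ≡⟨ x∙yz≈y∙xz (multichoose₃ P) (multichoose₂ (suc Q)) (multichoose₃ Q) ⟩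
    multichoose₂ (suc Q) + monoChainCount c n ∎
  where
  open ≡-Reasoning
  P Q : ℕ
  P = classSize c true n
  Q = classSize c false n

monoChain-supported : ∀ c → SupportedOnChains (monoChain c)
monoChain-supported c {i} {j} {l} ¬chain =
  𝟙-no (monoChain? c i j l) λ (i≤j , j≤l , _) → ¬chain (i≤j , j≤l)

monoChain-upper : ∀ c l → UpperTriangular (λ i j → monoChain c i j l)
monoChain-upper c l j<i = monoChain-supported c λ (i≤j , _) → ℕP.<⇒≱ j<i i≤j

column-monoChain-≡ : ∀ c {m l} → m ≤ l → c m ≡ c l →
  ∑[ i < suc m ] monoChain c i m l ≡ classSize c (c l) (suc m)
column-monoChain-≡ c {m} {l} m≤l cm≡cl = ∑<-cong (suc m) λ {i} i≤m → 𝟙-⇔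
  (mk⇔ (λ (_ , _ , ci≡cm , _) → trans ci≡cm cm≡cl)
       (λ ci≡cl → ℕP.≤-pred i≤m , m≤l , trans ci≡cl (sym cm≡cl) , cm≡cl))
  (monoChain? c i m l) (c i ≟ᵇ c l)

column-monoChain-≢ : ∀ c {m l} → c m ≢ c l → ∑[ i < suc m ] monoChain c i m l ≡ 0
column-monoChain-≢ c {m} {l} cm≢cl =
  ∑<-zero (suc m) λ {i} _ → 𝟙-no (monoChain? c i m l) λ (_ , _ , _ , cm≡cl) → cm≢cl cm≡cl

square-monoChain : ∀ c l m → m ≤ suc l →
  square m (λ i j → monoChain c i j l) ≡ multichoose₂ (classSize c (c l) m)
square-monoChain c l zero    _         = refl
square-monoChain c l (suc m) (s≤s m≤l) = begin
    square (suc m) G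
  ≡⟨ square-suc-upper m (monoChain-upper c l) ⟩
    (∑[ i < suc m ] monoChain c i m l) + square m G
  ≡⟨ cong (_+_ (∑[ i < suc m ] monoChain c i m l)) (square-monoChain c l m (ℕP.m≤n⇒m≤1+n m≤l)) ⟩
    (∑[ i < suc m ] monoChain c i m l) + multichoose₂ A
  ≡⟨ add-column (c m ≟ᵇ c l) ⟩
    multichoose₂ (classSize c (c l) (suc m)) ∎
  where
  open ≡-Reasoning
  G : ℕ → ℕ → ℕ
  G i j = monoChain c i j l
  A : ℕ
  A = classSize c (c l) m
  add-column : Dec (c m ≡ c l) →
    (∑[ i < suc m ] monoChain c i m l) + multichoose₂ A ≡ multichoose₂ (classSize c (c l) (suc m))
  add-column (yes cm≡cl) = begin
      (∑[ i < suc m ] monoChain c i m l) + multichoose₂ A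
    ≡⟨ cong (λ x → x + multichoose₂ A) (column-monoChain-≡ c m≤l cm≡cl) ⟩
      classSize c (c l) (suc m) + multichoose₂ A
    ≡⟨ cong (λ x → x + multichoose₂ A) (classSize-suc-≡ c m cm≡cl) ⟩
      suc A + multichoose₂ A
    ≡⟨ multichoose₂-suc A ⟨
      multichoose₂ (suc A)
    ≡⟨ cong multichoose₂ (classSize-suc-≡ c m cm≡cl) ⟨
      multichoose₂ (classSize c (c l) (suc m)) ∎
  add-column (no cm≢cl) = begin
      (∑[ i < suc m ] monoChain c i m l) + multichoose₂ A
    ≡⟨ cong (λ x → x + multichoose₂ A) (column-monoChain-≢ c cm≢cl) ⟩
      multichoose₂ A
    ≡⟨ cong multichoose₂ (classSize-suc-≢ c m cm≢cl) ⟨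
      multichoose₂ (classSize c (c l) (suc m)) ∎

cube-monoChain : ∀ c n → cube n (monoChain c) ≡ monoChainCount c n
cube-monoChain c zero    = refl
cube-monoChain c (suc n) = begin
    cube (suc n) (monoChain c)
  ≡⟨ cube-suc n (monoChain-supported c) ⟩
    square (suc n) (λ i j → monoChain c i j n) + cube n (monoChain c)
  ≡⟨ cong₂ _+_ (square-monoChain c n (suc n) ℕP.≤-refl) (cube-monoChain c n) ⟩
    multichoose₂ (classSize c (c n) (suc n)) + monoChainCount c n
  ≡⟨ monoChainCount-suc c n ⟨
    monoChainCount c (suc n) ∎
  where open ≡-Reasoning

monoSolution≡monoChain : ∀ {t} c {i j l} → suc i < t → monoSolution t c i j l ≡ monoChain c i j l
monoSolution≡monoChain {t} c {i} {j} {l} 1+i<t = 𝟙-⇔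
  (mk⇔ (λ (i≤j , j≤l , _ , mono) → i≤j , j≤l , mono)
       (λ (i≤j , j≤l , mono) → i≤j , j≤l , ℕP.+-mono-<-≤ 1+i<t j≤l , mono))
  (monoSolution? t c i j l) (monoChain? c i j l)

monoSolution-last-row : ∀ m c {j l} → l ≤ m → monoSolution (suc m) c m j l ≡ 0
monoSolution-last-row m c {j} {l} l≤m = 𝟙-no (monoSolution? (suc m) c m j l)
  λ (m≤j , _ , sumFree , _) →
    ℕP.<⇒≱ (ℕP.+-cancelˡ-< m j l (s<s⁻¹ sumFree)) (ℕP.≤-trans l≤m m≤j)

monoChain-last-row : ∀ c m → ∑[ j < suc m ] ∑[ l < suc m ] monoChain c m j l ≡ 1
monoChain-last-row c m = cong₂ _+_
  (cong₂ _+_ (𝟙-yes (monoChain? c m m m) (ℕP.≤-refl , ℕP.≤-refl , refl , refl))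
             (∑<-zero m λ {l} l<m → 𝟙-no (monoChain? c m m l) λ (_ , m≤l , _) → ℕP.<⇒≱ l<m m≤l))
  (∑<-zero m λ {j} j<m → ∑<-zero (suc m) λ {l} _ →
    𝟙-no (monoChain? c m j l) λ (m≤j , _) → ℕP.<⇒≱ j<m m≤j)

cube-monoSolution : ∀ t c n → 0 < n → n ≤ t →
  cube n (monoSolution t c) + 𝟙 (n ≟ t) ≡ cube n (monoChain c)
cube-monoSolution t c (suc m) _ 1+m≤t with ℕP.m≤n⇒m<n∨m≡n 1+m≤t
... | inj₁ 1+m<t = begin
    cube (suc m) (monoSolution t c) + 𝟙 (suc m ≟ t)
  ≡⟨ cong (_+_ (cube (suc m) (monoSolution t c))) (𝟙-no (suc m ≟ t) (ℕP.<⇒≢ 1+m<t)) ⟩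
    cube (suc m) (monoSolution t c) + 0
  ≡⟨ ℕP.+-identityʳ _ ⟩
    cube (suc m) (monoSolution t c)
  ≡⟨ ∑<-cong (suc m) (λ i<1+m → ∑<-cong (suc m) λ _ → ∑<-cong (suc m) λ _ →
       monoSolution≡monoChain c (ℕP.≤-<-trans i<1+m 1+m<t)) ⟩
    cube (suc m) (monoChain c) ∎
  where open ≡-Reasoning
... | inj₂ refl = begin
    cube (suc m) (monoSolution (suc m) c) + 𝟙 (suc m ≟ suc m)
  ≡⟨ cong₂ _+_ (cong₂ _+_ last-row lower-rows) (𝟙-yes (suc m ≟ suc m) refl) ⟩
    lower + 1
  ≡⟨ ℕP.+-comm lower 1 ⟩
    1 + lower
  ≡⟨ cong (λ x → x + lower) (monoChain-last-row c m) ⟨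
    cube (suc m) (monoChain c) ∎
  where
  open ≡-Reasoning
  lower : ℕ
  lower = ∑[ i < m ] ∑[ j < suc m ] ∑[ l < suc m ] monoChain c i j l
  last-row : ∑[ j < suc m ] ∑[ l < suc m ] monoSolution (suc m) c m j l ≡ 0
  last-row = ∑<-zero (suc m) λ _ → ∑<-zero (suc m) λ l<1+m →
    monoSolution-last-row m c (ℕP.≤-pred l<1+m)
  lower-rows : ∑[ i < m ] ∑[ j < suc m ] ∑[ l < suc m ] monoSolution (suc m) c i j l ≡ lower
  lower-rows = ∑<-cong m λ i<m → ∑<-cong (suc m) λ _ → ∑<-cong (suc m) λ _ →
    monoSolution≡monoChain c (s≤s i<m)

countMono-closedForm : ∀ t n Δ → 0 < n → n ≤ t →
  countMono (- + t) n Δ ≡ monoChainCount (Δ ∘ shift (- + t)) n ∸ 𝟙 (n ≟ t)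
countMono-closedForm t n Δ 0<n n≤t = begin
    countMono (- + t) n Δ
  ≡⟨ countMono-as-cube (- + t) n Δ ⟩
    cube n (λ i j l → 𝟙 (monoSolutionℤ? Δ (shift (- + t) i) (shift (- + t) j) (shift (- + t) l)))
  ≡⟨ cube-cong n (monoSolutionℤ-shift t Δ) ⟩
    cube n (monoSolution t c)
  ≡⟨ ℕP.m+n∸n≡m (cube n (monoSolution t c)) (𝟙 (n ≟ t)) ⟨
    cube n (monoSolution t c) + 𝟙 (n ≟ t) ∸ 𝟙 (n ≟ t)
  ≡⟨ cong (λ x → x ∸ 𝟙 (n ≟ t)) (cube-monoSolution t c n 0<n n≤t) ⟩
    cube n (monoChain c) ∸ 𝟙 (n ≟ t)
  ≡⟨ cong (λ x → x ∸ 𝟙 (n ≟ t)) (cube-monoChain c n) ⟩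
    monoChainCount c n ∸ 𝟙 (n ≟ t) ∎
  where
  open ≡-Reasoning
  c : ℕ → Bool
  c = Δ ∘ shift (- + t)

-- Convexity

-- f (x + 1) - f x is nondecreasing, stated without truncated subtraction.
DiscretelyConvex : (ℕ → ℕ) → Set
DiscretelyConvex f = ∀ {x y} → x ≤ y → f y + f (suc x) ≤ f (suc y) + f x

module _ {f : ℕ → ℕ} (convex : DiscretelyConvex f) where

  balanced-≤-gap : ∀ d q → f ⌊ d + q + q /2⌋ + f ⌊ suc (d + q + q) /2⌋ ≤ f (d + q) + f q
  balanced-≤-gap zero q = ℕP.≤-reflexive
    (cong₂ (λ x y → f x + f y) (sym (ℕP.n≡⌊n+n/2⌋ q)) (sym (ℕP.n≡⌈n+n/2⌉ q)))
  balanced-≤-gap (suc zero) q = ℕP.≤-reflexive (trans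
    (cong₂ (λ x y → f x + f (suc y)) (sym (ℕP.n≡⌈n+n/2⌉ q)) (sym (ℕP.n≡⌊n+n/2⌋ q)))
    (ℕP.+-comm (f q) (f (suc q))))
  balanced-≤-gap (suc (suc d)) q = begin
      f (suc ⌊ d + q + q /2⌋) + f (suc ⌊ suc (d + q + q) /2⌋)
    ≡⟨ cong (λ s → f ⌊ s /2⌋ + f ⌊ suc s /2⌋) recentre ⟨
      f ⌊ d + suc q + suc q /2⌋ + f ⌊ suc (d + suc q + suc q) /2⌋
    ≤⟨ balanced-≤-gap d (suc q) ⟩
      f (d + suc q) + f (suc q)
    ≡⟨ cong (λ x → f x + f (suc q)) (ℕP.+-suc d q) ⟩
      f (suc (d + q)) + f (suc q)
    ≤⟨ convex (ℕP.m≤n⇒m≤1+n (ℕP.m≤n+m q d)) ⟩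
      f (suc (suc (d + q))) + f q ∎
    where
    open ℕP.≤-Reasoning
    recentre : d + suc q + suc q ≡ suc (suc (d + q + q))
    recentre = trans (cong (λ x → x + suc q) (ℕP.+-suc d q)) (cong suc (ℕP.+-suc (d + q) q))

  balanced-≤-ordered : ∀ {p q} → q ≤ p → f ⌊ p + q /2⌋ + f ⌊ suc (p + q) /2⌋ ≤ f p + f q
  balanced-≤-ordered {p} {q} q≤p =
    subst (λ p → f ⌊ p + q /2⌋ + f ⌊ suc (p + q) /2⌋ ≤ f p + f q) (ℕP.m∸n+n≡m q≤p)
      (balanced-≤-gap (p ∸ q) q)

  balanced-≤ : ∀ p q → f ⌊ p + q /2⌋ + f ⌊ suc (p + q) /2⌋ ≤ f p + f q
  balanced-≤ p q with ℕP.≤-total q p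
  ... | inj₁ q≤p = balanced-≤-ordered q≤p
  ... | inj₂ p≤q = subst₂ _≤_
    (cong (λ s → f ⌊ s /2⌋ + f ⌊ suc s /2⌋) (ℕP.+-comm q p)) (ℕP.+-comm (f q) (f p))
    (balanced-≤-ordered p≤q)

multichoose₃-convex : DiscretelyConvex multichoose₃
multichoose₃-convex {x} {y} x≤y = begin
    multichoose₃ y + multichoose₃ (suc x)
  ≡⟨ cong (_+_ (multichoose₃ y)) (multichoose₃-suc x) ⟩
    multichoose₃ y + (multichoose₂ (suc x) + multichoose₃ x)
  ≤⟨ ℕP.+-monoʳ-≤ (multichoose₃ y)
       (ℕP.+-monoˡ-≤ (multichoose₃ x) (multichoose₂-mono (s≤s x≤y))) ⟩
    multichoose₃ y + (multichoose₂ (suc y) + multichoose₃ x)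
  ≡⟨ x∙yz≈yx∙z (multichoose₃ y) (multichoose₂ (suc y)) (multichoose₃ x) ⟩
    multichoose₂ (suc y) + multichoose₃ y + multichoose₃ x
  ≡⟨ cong (λ z → z + multichoose₃ x) (multichoose₃-suc y) ⟨
    multichoose₃ (suc y) + multichoose₃ x ∎
  where open ℕP.≤-Reasoning

balancedCount : ℕ → ℕ
balancedCount n = multichoose₃ ⌊ n /2⌋ + multichoose₃ ⌊ suc n /2⌋

balancedCount-≤-monoChainCount : ∀ c n → balancedCount n ≤ monoChainCount c n
balancedCount-≤-monoChainCount c n =
  subst (λ m → balancedCount m ≤ monoChainCount c n) (classSize-true+false c n)
    (balanced-≤ {multichoose₃} multichoose₃-convex (classSize c true n) (classSize c false n))

-- The balanced coloring

fromList-head : ∀ a x bs → fromList a (x ∷ bs) (a ℤ.+ + 0) ≡ x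
fromList-head a x bs rewrite dec-true ((a ℤ.+ + 0) ℤP.≟ a) (ℤP.+-identityʳ a) = refl

fromList-tail : ∀ a x bs i →
  fromList a (x ∷ bs) (a ℤ.+ + suc i) ≡ fromList (a ℤ.+ + 1) bs (a ℤ.+ + 1 ℤ.+ + i)
fromList-tail a x bs i rewrite dec-false ((a ℤ.+ + suc i) ℤP.≟ a) (+-translate-suc-≢ a i) =
  cong (fromList (a ℤ.+ + 1) bs) (trans (cong (ℤ._+_ a) (ℤP.pos-+ 1 i)) (sym (ℤP.+-assoc a (+ 1) (+ i))))

occurrences : Bool → List Bool → ℕ
occurrences b bs = sum (map (λ x → 𝟙 (x ≟ᵇ b)) bs)

classSize-fromList : ∀ a bs b →
  classSize (λ i → fromList a bs (a ℤ.+ + i)) b (length bs) ≡ occurrences b bs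
classSize-fromList a []       b = refl
classSize-fromList a (x ∷ bs) b = begin
    classSize c b (suc (length bs))
  ≡⟨ ∑<-shift (length bs) (λ i → 𝟙 (c i ≟ᵇ b)) ⟩
    𝟙 (c 0 ≟ᵇ b) + (∑[ i < length bs ] 𝟙 (c (suc i) ≟ᵇ b))
  ≡⟨ cong₂ (λ y s → 𝟙 (y ≟ᵇ b) + s) (fromList-head a x bs)
       (∑<-cong (length bs) λ {i} _ → cong (λ y → 𝟙 (y ≟ᵇ b)) (fromList-tail a x bs i)) ⟩
    𝟙 (x ≟ᵇ b) + classSize (λ i → fromList (a ℤ.+ + 1) bs (a ℤ.+ + 1 ℤ.+ + i)) b (length bs)
  ≡⟨ cong (_+_ (𝟙 (x ≟ᵇ b))) (classSize-fromList (a ℤ.+ + 1) bs b) ⟩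
    occurrences b (x ∷ bs) ∎
  where
  open ≡-Reasoning
  c : ℕ → Bool
  c i = fromList a (x ∷ bs) (a ℤ.+ + i)

twoBlocks : ℕ → ℕ → List Bool
twoBlocks p q = replicate p true ++ replicate q false

length-twoBlocks : ∀ p q → length (twoBlocks p q) ≡ p + q
length-twoBlocks p q =
  trans (length-++ (replicate p true)) (cong₂ _+_ (length-replicate p) (length-replicate q))

occurrences-twoBlocks : ∀ p q →
  occurrences true (twoBlocks p q) ≡ p × occurrences false (twoBlocks p q) ≡ q
occurrences-twoBlocks (suc p) q       = Product.map (cong suc) id (occurrences-twoBlocks p q)
occurrences-twoBlocks zero    zero    = refl , refl
occurrences-twoBlocks zero    (suc q) = Product.map id (cong suc) (occurrences-twoBlocks zero q)

balancedBlocks : ℕ → List Bool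
balancedBlocks n = twoBlocks ⌊ n /2⌋ ⌊ suc n /2⌋

length-balancedBlocks : ∀ n → length (balancedBlocks n) ≡ n
length-balancedBlocks n = trans (length-twoBlocks ⌊ n /2⌋ ⌊ suc n /2⌋) (ℕP.⌊n/2⌋+⌈n/2⌉≡n n)

monoChainCount-balancedBlocks : ∀ a n →
  monoChainCount (λ i → fromList a (balancedBlocks n) (a ℤ.+ + i)) n ≡ balancedCount n
monoChainCount-balancedBlocks a n = begin
    monoChainCount c n
  ≡⟨ cong (monoChainCount c) (length-balancedBlocks n) ⟨
    monoChainCount c (length (balancedBlocks n))
  ≡⟨ cong₂ (λ x y → multichoose₃ x + multichoose₃ y)
       (trans (classSize-fromList a (balancedBlocks n) true) (proj₁ counts))
       (trans (classSize-fromList a (balancedBlocks n) false) (proj₂ counts)) ⟩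
    balancedCount n ∎
  where
  open ≡-Reasoning
  c : ℕ → Bool
  c i = fromList a (balancedBlocks n) (a ℤ.+ + i)
  counts : occurrences true (balancedBlocks n) ≡ ⌊ n /2⌋
         × occurrences false (balancedBlocks n) ≡ ⌊ suc n /2⌋
  counts = occurrences-twoBlocks ⌊ n /2⌋ ⌊ suc n /2⌋

∈-boolLists : ∀ bs → bs ∈ boolLists (length bs)
∈-boolLists []       = here refl
∈-boolLists (b ∷ bs) = ∈-concatMap⁺ _ (Any.map (λ { refl → extend b }) (∈-boolLists bs))
  where
  extend : ∀ b → b ∷ bs ∈ (false ∷ bs) ∷ (true ∷ bs) ∷ []
  extend false = here refl
  extend true  = there (here refl)

minList-≡ : ∀ {d m xs} → m ∈ xs → All (m ≤_) xs → minList d xs ≡ m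
minList-≡ {m = m} {x ∷ xs} m∈x∷xs (m≤x ∷ m≤xs) = ℕP.≤-antisym
  (foldr-preservesᵒ (λ y z → [ ℕP.m≤n⇒m⊓o≤n z , ℕP.m≤n⇒o⊓m≤n y ]) x xs (below m∈x∷xs))
  (foldr-preservesᵇ ℕP.⊓-glb m≤x m≤xs)
  where
  below : m ∈ x ∷ xs → x ≤ m ⊎ Any.Any (_≤ m) xs
  below (here m≡x)  = inj₁ (ℕP.≤-reflexive (sym m≡x))
  below (there m∈xs) = inj₂ (Any.map (ℕP.≤-reflexive ∘ sym) m∈xs)

countMono-≥ : ∀ t n Δ → 0 < n → n ≤ t → balancedCount n ∸ 𝟙 (n ≟ t) ≤ countMono (- (+ t)) n Δ
countMono-≥ t n Δ 0<n n≤t =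
  subst (balancedCount n ∸ 𝟙 (n ≟ t) ≤_) (sym (countMono-closedForm t n Δ 0<n n≤t))
    (ℕP.∸-monoˡ-≤ (𝟙 (n ≟ t)) (balancedCount-≤-monoChainCount (Δ ∘ shift (- (+ t))) n))

countMono-balancedBlocks : ∀ t n → 0 < n → n ≤ t →
  countMono (- (+ t)) n (fromList (- (+ t) ℤ.+ + 1) (balancedBlocks n)) ≡ balancedCount n ∸ 𝟙 (n ≟ t)
countMono-balancedBlocks t n 0<n n≤t =
  trans (countMono-closedForm t n (fromList (- (+ t) ℤ.+ + 1) (balancedBlocks n)) 0<n n≤t)
        (cong (λ x → x ∸ 𝟙 (n ≟ t)) (monoChainCount-balancedBlocks (- (+ t) ℤ.+ + 1) n))

M-closedForm : ∀ t n → 0 < n → n ≤ t → M (- (+ t)) n ≡ balancedCount n ∸ 𝟙 (n ≟ t)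
M-closedForm t n 0<n n≤t = minList-≡
  (subst (_∈ map (countMono (- (+ t)) n) (allColorings (- (+ t)) n))
    (countMono-balancedBlocks t n 0<n n≤t)
    (∈-map⁺ (countMono (- (+ t)) n) (∈-map⁺ (fromList (- (+ t) ℤ.+ + 1))
      (subst (λ m → balancedBlocks n ∈ boolLists m) (length-balancedBlocks n)
        (∈-boolLists (balancedBlocks n))))))
  (AllP.map⁺ (All.universal (λ Δ → countMono-≥ t n Δ 0<n n≤t) _))

n/2≡⌊n/2⌋ : ∀ n → n / 2 ≡ ⌊ n /2⌋
n/2≡⌊n/2⌋ zero          = refl
n/2≡⌊n/2⌋ (suc zero)    = refl
n/2≡⌊n/2⌋ (suc (suc n)) =
  trans (m/n≡1+[m∸n]/n {suc (suc n)} {2} (s≤s (s≤s z≤n))) (cong suc (n/2≡⌊n/2⌋ n))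

balancedCount-as-binomials : ∀ n → balancedCount n ≡ ((n / 2 + 2) C 3) + ((⌈ n /2⌉ + 2) C 3)
balancedCount-as-binomials n =
  sym (cong₂ (λ x y → x C 3 + y C 3) (half-plus-2 n) (half-plus-2 (suc n)))
  where
  half-plus-2 : ∀ m → m / 2 + 2 ≡ 2 + ⌊ m /2⌋
  half-plus-2 m = trans (ℕP.+-comm (m / 2) 2) (cong (_+_ 2) (n/2≡⌊n/2⌋ m))

theorem3p1 : (t n : ℕ) → 2 ≤ t → 1 ≤ n → n ≤ t →
    (n < t → M (- (+ t)) n ≡ ((n / 2 + 2) C 3) + ((⌈ n /2⌉ + 2) C 3))
    × (n ≡ t → M (- (+ t)) n ≡ ((t / 2 + 2) C 3) + ((⌈ t /2⌉ + 2) C 3) ∸ 1)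
theorem3p1 t n _ 1≤n n≤t = below-t , at-t
  where
  open ≡-Reasoning
  below-t : n < t → M (- (+ t)) n ≡ ((n / 2 + 2) C 3) + ((⌈ n /2⌉ + 2) C 3)
  below-t n<t = begin
      M (- (+ t)) n
    ≡⟨ M-closedForm t n 1≤n n≤t ⟩
      balancedCount n ∸ 𝟙 (n ≟ t)
    ≡⟨ cong (balancedCount n ∸_) (𝟙-no (n ≟ t) (ℕP.<⇒≢ n<t)) ⟩
      balancedCount n
    ≡⟨ balancedCount-as-binomials n ⟩
      ((n / 2 + 2) C 3) + ((⌈ n /2⌉ + 2) C 3) ∎
  at-t : n ≡ t → M (- (+ t)) n ≡ ((t / 2 + 2) C 3) + ((⌈ t /2⌉ + 2) C 3) ∸ 1
  at-t refl = begin
      M (- (+ t)) t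
    ≡⟨ M-closedForm t t 1≤n n≤t ⟩
      balancedCount t ∸ 𝟙 (t ≟ t)
    ≡⟨ cong₂ _∸_ (balancedCount-as-binomials t) (𝟙-yes (t ≟ t) refl) ⟩
      ((t / 2 + 2) C 3) + ((⌈ t /2⌉ + 2) C 3) ∸ 1 ∎
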